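{- Let $q$ be an odd prime, $v(x)\in\mathrm{GF}(q)[x]$ nonzero, $f(x,y)=y^2+y-v(x)$, and let $(x_k)_{k\ge1}$ be a sequence with $x_1\in\mathrm{GF}(q^2)$ and, for $k\ge 2$, $x_k$ a root of $f(x_{k-1},y)$ with $x_k\notin \mathrm{GF}(q^{2^{k-1}})$, all $x_k$ nonzero, and satisfying Condition (1). Let $n\ge2$ and $1\le j<n$ be integers. Then $$\frac{\mathrm{N}_{n,j}(x_n)}{x_{n-j}}=\prod_{k=1}^{j}\mathrm{N}_{n-k,j-k}\left(\frac{\mathrm{N}_{n-k+1,1}(x_{n-k+1})}{x_{n-k}}\right),$$ and moreover $\frac{\mathrm{N}_{n,j}(x_n)}{x_{n-j}}$ is a square in $\mathrm{GF}(q^{2^{n-j}})$.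
   Context: $\mathrm{GF}(q^m)$ denotes the field with $q^m$ elements. For $0\le j<n$, $\mathrm{N}_{n,j}\colon\mathrm{GF}(q^{2^n})\to\mathrm{GF}(q^{2^{n-j}})$ is the norm map $\mathrm{N}_{n,j}(x)=x^{\prod_{i=1}^{j}(q^{2^{n-i}}+1)}$, with $\mathrm{N}_{n,0}(x)=x$. Condition (1): for all $k\ge2$, $f(x_{k-1},0)/x_{k-1}$ is a square in $\mathrm{GF}(q^{2^{k-1}})$. -}

module Defs where

open import Level using (Level; _⊔_) renaming (suc to lsuc)
open import Algebra.Bundles using (CommutativeRing)
open import Data.Nat using (ℕ; zero; suc; _∸_) renaming (_+_ to _+ℕ_; _*_ to _*ℕ_; _^_ to _^ℕ_)
open import Data.Fin using (Fin; toℕ) renaming (zero to fzero)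
open import Data.List using (List; []; _∷_)
open import Data.List.Relation.Unary.Any using (Any)
open import Data.Product using (Σ; _×_)
open import Relation.Nullary using (¬_)
open import Relation.Binary.PropositionalEquality using (_≡_)

-- The inverse is given as a total
-- function; its value at 0 is irrelevant (we only divide by nonzero elements).
record Field (c ℓ : Level) : Set (lsuc (c ⊔ ℓ)) where
  field
    commutativeRing : CommutativeRing c ℓ
  open CommutativeRing commutativeRing public
  field
    _⁻¹      : Carrier → Carrier
    1≉0      : ¬ (1# ≈ 0#)
    inverseʳ : ∀ x → ¬ (x ≈ 0#) → (x * (x ⁻¹)) ≈ 1#

module FieldNotions {c ℓ : Level} (F : Field c ℓ) where
  open Field F

  _^ᶠ_ : Carrier → ℕ → Carrier
  x ^ᶠ zero  = 1#
  x ^ᶠ suc n = x * (x ^ᶠ n)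

  _÷_ : Carrier → Carrier → Carrier
  a ÷ b = a * (b ⁻¹)

  ι : ℕ → Carrier
  ι zero    = 0#
  ι (suc n) = 1# + ι n

  -- Polynomials over GF(q) = Fin q as coefficient lists (constant term first)
  -- A polynomial is nonzero iff some coefficient is nonzero.
  NonZeroPoly : {q : ℕ} → List (Fin q) → Set
  NonZeroPoly {q} v = Any (λ a → ¬ (toℕ a ≡ 0)) v

  eval : {q : ℕ} → List (Fin q) → Carrier → Carrier
  eval []       x = 0#
  eval (a ∷ as) x = ι (toℕ a) + (x * eval as x)

  -- For a field F of characteristic q (containing GF(q)), GF(q^m) inside F
  -- is the set of fixed points of the m-th power of Frobenius.
  InGF : (q m : ℕ) → Carrier → Set ℓ
  InGF q m x = (x ^ᶠ (q ^ℕ m)) ≈ x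

  IsSquareIn : (q m : ℕ) → Carrier → Set (c ⊔ ℓ)
  IsSquareIn q m z = Σ Carrier (λ y → InGF q m y × ((y * y) ≈ z))

  normExp : (q n j : ℕ) → ℕ
  normExp q n zero    = 1
  normExp q n (suc j) = normExp q n j *ℕ ((q ^ℕ (2 ^ℕ (n ∸ suc j))) +ℕ 1)

  N : (q n j : ℕ) → Carrier → Carrier
  N q n j x = x ^ᶠ normExp q n j

  prod : (ℕ → Carrier) → ℕ → Carrier
  prod g zero    = 1#
  prod g (suc j) = prod g j * g (suc j)

  fxy : {q : ℕ} → List (Fin q) → Carrier → Carrier → Carrier
  fxy v x y = ((y * y) + y) - eval v x

-- The identity telescopes because N_{m,i} ∘ N_{m+1,1} = N_{m+1,i+1}.  For squareness: by induction
-- x_m ∈ GF(q^{2^m}), so the q^{2^m}-Frobenius permutes the roots x_{m+1} and −(x_{m+1} + 1) of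
-- y² + y = v(x_m); as x_{m+1} ∉ GF(q^{2^m}) it swaps them, whence N_{m+1,1}(x_{m+1}) = −x_{m+1}(x_{m+1} + 1)
-- = f(x_m, 0).  Each factor is thus a norm of f(x_m, 0)/x_m, a square by Condition (1), and the norm
-- N_{m,i} maps squares of GF(q^{2^m}) to squares of GF(q^{2^{m−i}}).

module Submission where

open import Defs
open import Level using (Level)
open import Data.Nat using (ℕ; _∸_; _^_; _≤_; _<_; _%_)
open import Data.Nat using () renaming (_+_ to _+ℕ_)
open import Data.Nat.Primality using (Prime)
open import Data.Fin using (Fin)
open import Data.List using (List)
open import Data.Product using (_×_)
open import Relation.Nullary using (¬_)
open import Relation.Binary.PropositionalEquality using (_≡_)

open import Data.Nat as ℕ using (zero; suc; z≤n; s≤s; _!)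
import Data.Nat.Properties as ℕ
open import Data.Nat.Tactic.RingSolver using (solve-∀)
open import Data.Nat.Divisibility using (_∣_; divides; ∣⇒≤; ∣1⇒≡1; m∣m*n)
open import Data.Nat.DivMod using (m/n*n≡m)
open import Data.Nat.Combinatorics using (_C_; nCk≡n!/k![n-k]!; k![n∸k]!∣n!; nCn≡1; nCk≡nC[n∸k])
open import Data.Nat.Primality using (euclidsLemma; ¬prime[0]; ¬prime[1])
open import Data.Fin using (toℕ; fromℕ; inject₁) renaming (zero to fzero; suc to fsuc)
open import Data.Fin.Properties using (toℕ-fromℕ; inject₁ℕ<)
open import Data.List using ([]; _∷_)
open import Data.Product using (_,_)
open import Data.Sum using (inj₁; inj₂)
open import Data.Empty using (⊥-elim)
import Relation.Binary.PropositionalEquality as ≡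
import Algebra.Properties.Ring as RingProperties
import Algebra.Properties.Semiring.Mult as SemiringMultiplication
import Algebra.Properties.Semiring.Exp as SemiringExponentiation
import Algebra.Properties.Semiring.Sum as SemiringSum
import Algebra.Properties.CommutativeSemiring.Binomial as Binomial
import Algebra.Solver.CommutativeMonoid as CommutativeMonoidSolver

prime∣n!⇒p≤n : ∀ {p} n → Prime p → p ∣ n ! → p ≤ n
prime∣n!⇒p≤n zero    p-prime p∣1 = ⊥-elim (¬prime[1] (≡.subst Prime (∣1⇒≡1 p∣1) p-prime))
prime∣n!⇒p≤n (suc n) p-prime p∣n! with euclidsLemma (suc n) (n !) p-prime p∣n!
... | inj₁ p∣1+n = ∣⇒≤ p∣1+n
... | inj₂ p∣n!′ = ℕ.m≤n⇒m≤1+n (prime∣n!⇒p≤n n p-prime p∣n!′)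

n!≡nCk*[k!*[n∸k]!] : ∀ {n k} → k ≤ n → n ! ≡ (n C k) ℕ.* (k ! ℕ.* (n ∸ k) !)
n!≡nCk*[k!*[n∸k]!] {n} {k} k≤n = ≡.trans
  (≡.sym (m/n*n≡m {{k ℕ.!* (n ∸ k) !≢0}} (k![n∸k]!∣n! k≤n)))
  (≡.cong (ℕ._* (k ! ℕ.* (n ∸ k) !)) (≡.sym (nCk≡n!/k![n-k]! k≤n)))

-- p divides p! = pCk · k! · (p − k)!, but neither k! nor (p − k)!.
prime∣pCk : ∀ {p k} → Prime p → 0 < k → k < p → p ∣ p C k
prime∣pCk {zero}  ()
prime∣pCk {suc p} {k} p-prime 0<k k<p
  with euclidsLemma (suc p C k) _ p-prime
         (≡.subst (suc p ∣_) (n!≡nCk*[k!*[n∸k]!] (ℕ.<⇒≤ k<p)) (m∣m*n (p !)))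
... | inj₁ p∣pCk = p∣pCk
... | inj₂ p∣k![p∸k]! with euclidsLemma (k !) _ p-prime p∣k![p∸k]!
...   | inj₁ p∣k! = ⊥-elim (ℕ.<⇒≱ k<p (prime∣n!⇒p≤n k p-prime p∣k!))
...   | inj₂ p∣[p∸k]! =
  ⊥-elim (ℕ.<⇒≱ (ℕ.∸-monoʳ-< 0<k (ℕ.<⇒≤ k<p)) (prime∣n!⇒p≤n _ p-prime p∣[p∸k]!))

q^2^[1+t]≡q^2^t*q^2^t : ∀ q t → q ^ (2 ^ suc t) ≡ q ^ (2 ^ t) ℕ.* q ^ (2 ^ t)
q^2^[1+t]≡q^2^t*q^2^t q t = ≡.trans (ℕ.^-distribˡ-+-* q (2 ^ t) (2 ^ t ℕ.+ 0))
  (≡.cong (λ e → q ^ (2 ^ t) ℕ.* q ^ e) (ℕ.+-identityʳ (2 ^ t)))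

1+[m∸1+k]≡m∸k : ∀ {m k} → k < m → suc (m ∸ suc k) ≡ m ∸ k
1+[m∸1+k]≡m∸k k<m = ≡.sym (ℕ.+-∸-assoc 1 k<m)

[n∸k]∸[j∸k]≡n∸j : ∀ n {j k} → k ≤ j → (n ∸ k) ∸ (j ∸ k) ≡ n ∸ j
[n∸k]∸[j∸k]≡n∸j n {j} {k} k≤j = ≡.trans (ℕ.∸-+-assoc n k (j ∸ k)) (≡.cong (n ∸_) (ℕ.m+[n∸m]≡n k≤j))

module FieldTheory {c ℓ : Level} (F : Field c ℓ) where
  open Field F
  open FieldNotions F
  open RingProperties ring
  open import Relation.Binary.Reasoning.Setoid setoid
  open SemiringMultiplication semiring using (×-assocˡ; ×-congʳ; ×-homo-1) renaming (_×_ to _·_)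
  open SemiringExponentiation semiring using () renaming (_^_ to _^ˢ_)
  open SemiringSum semiring using (sum; sum-cong-≋; sum-init-last; sum-replicate-zero)
  open Binomial commutativeSemiring using (theorem; binomialTerm)
  module *-Solver = CommutativeMonoidSolver *-commutativeMonoid
  module +-Solver = CommutativeMonoidSolver +-commutativeMonoid

  x*y≈0⇒y≈0 : ∀ {x y} → ¬ x ≈ 0# → x * y ≈ 0# → y ≈ 0#
  x*y≈0⇒y≈0 {x} {y} x≉0 xy≈0 = begin
    y                  ≈⟨ *-identityˡ y ⟨
    1# * y             ≈⟨ *-congʳ (trans (*-comm _ _) (inverseʳ x x≉0)) ⟨
    (x ⁻¹ * x) * y     ≈⟨ *-assoc _ x y ⟩
    x ⁻¹ * (x * y)     ≈⟨ *-congˡ xy≈0 ⟩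
    x ⁻¹ * 0#          ≈⟨ zeroʳ _ ⟩
    0#                 ∎

  x*y≉0 : ∀ {x y} → ¬ x ≈ 0# → ¬ y ≈ 0# → ¬ x * y ≈ 0#
  x*y≉0 x≉0 y≉0 xy≈0 = y≉0 (x*y≈0⇒y≈0 x≉0 xy≈0)

  ⁻¹-unique : ∀ {x y} → ¬ x ≈ 0# → x * y ≈ 1# → y ≈ x ⁻¹
  ⁻¹-unique {x} {y} x≉0 xy≈1 = begin
    y                  ≈⟨ *-identityˡ y ⟨
    1# * y             ≈⟨ *-congʳ (inverseʳ x x≉0) ⟨
    (x * x ⁻¹) * y     ≈⟨ *-Solver.solve 3 (λ a b c → (a ⊕ b) ⊕ c ⊜ b ⊕ (a ⊕ c)) refl x (x ⁻¹) y ⟩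
    x ⁻¹ * (x * y)     ≈⟨ *-congˡ xy≈1 ⟩
    x ⁻¹ * 1#          ≈⟨ *-identityʳ _ ⟩
    x ⁻¹               ∎
    where open *-Solver

  ⁻¹-cong : ∀ {x y} → ¬ y ≈ 0# → x ≈ y → x ⁻¹ ≈ y ⁻¹
  ⁻¹-cong {x} y≉0 x≈y =
    ⁻¹-unique y≉0 (trans (*-congʳ (sym x≈y)) (inverseʳ x (λ x≈0 → y≉0 (trans (sym x≈y) x≈0))))

  x÷y*[y÷z]≈x÷z : ∀ x {y} z → ¬ y ≈ 0# → (x ÷ y) * (y ÷ z) ≈ x ÷ z
  x÷y*[y÷z]≈x÷z x {y} z y≉0 = begin
    (x * y ⁻¹) * (y * z ⁻¹)
      ≈⟨ *-Solver.solve 4 (λ a b c d → (a ⊕ b) ⊕ (c ⊕ d) ⊜ a ⊕ ((c ⊕ b) ⊕ d)) refl x (y ⁻¹) y (z ⁻¹) ⟩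
    x * ((y * y ⁻¹) * z ⁻¹)  ≈⟨ *-congˡ (*-congʳ (inverseʳ y y≉0)) ⟩
    x * (1# * z ⁻¹)          ≈⟨ *-congˡ (*-identityˡ _) ⟩
    x * z ⁻¹                 ∎
    where open *-Solver

  ^ᶠ-congˡ : ∀ n {x y} → x ≈ y → x ^ᶠ n ≈ y ^ᶠ n
  ^ᶠ-congˡ zero    x≈y = refl
  ^ᶠ-congˡ (suc n) x≈y = *-cong x≈y (^ᶠ-congˡ n x≈y)

  ^ᶠ-identityʳ : ∀ x → x ^ᶠ 1 ≈ x
  ^ᶠ-identityʳ = *-identityʳ

  ^ᶠ-zeroˡ : ∀ n → 1# ^ᶠ n ≈ 1#
  ^ᶠ-zeroˡ zero    = refl
  ^ᶠ-zeroˡ (suc n) = trans (*-identityˡ _) (^ᶠ-zeroˡ n)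

  ^ᶠ-homo-* : ∀ x m n → x ^ᶠ (m ℕ.+ n) ≈ x ^ᶠ m * x ^ᶠ n
  ^ᶠ-homo-* x zero    n = sym (*-identityˡ _)
  ^ᶠ-homo-* x (suc m) n = trans (*-congˡ (^ᶠ-homo-* x m n)) (sym (*-assoc _ _ _))

  ^ᶠ-assocʳ : ∀ x m n → (x ^ᶠ m) ^ᶠ n ≈ x ^ᶠ (m ℕ.* n)
  ^ᶠ-assocʳ x m zero    = ≡.subst (λ e → 1# ≈ x ^ᶠ e) (≡.sym (ℕ.*-zeroʳ m)) refl
  ^ᶠ-assocʳ x m (suc n) = begin
    x ^ᶠ m * (x ^ᶠ m) ^ᶠ n    ≈⟨ *-congˡ (^ᶠ-assocʳ x m n) ⟩
    x ^ᶠ m * x ^ᶠ (m ℕ.* n)   ≈⟨ ^ᶠ-homo-* x m (m ℕ.* n) ⟨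
    x ^ᶠ (m ℕ.+ m ℕ.* n)      ≡⟨ ≡.cong (x ^ᶠ_) (ℕ.*-suc m n) ⟨
    x ^ᶠ (m ℕ.* suc n)        ∎

  ^ᶠ-distrib-* : ∀ x y n → (x * y) ^ᶠ n ≈ x ^ᶠ n * y ^ᶠ n
  ^ᶠ-distrib-* x y zero    = sym (*-identityˡ 1#)
  ^ᶠ-distrib-* x y (suc n) = begin
    (x * y) * (x * y) ^ᶠ n        ≈⟨ *-congˡ (^ᶠ-distrib-* x y n) ⟩
    (x * y) * (x ^ᶠ n * y ^ᶠ n)
      ≈⟨ *-Solver.solve 4 (λ a b c d → (a ⊕ b) ⊕ (c ⊕ d) ⊜ (a ⊕ c) ⊕ (b ⊕ d)) refl x y (x ^ᶠ n) (y ^ᶠ n) ⟩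
    (x * x ^ᶠ n) * (y * y ^ᶠ n)   ∎
    where open *-Solver

  ^ᶠ-≉0 : ∀ {x} n → ¬ x ≈ 0# → ¬ x ^ᶠ n ≈ 0#
  ^ᶠ-≉0 zero    x≉0 = 1≉0
  ^ᶠ-≉0 (suc n) x≉0 = x*y≉0 x≉0 (^ᶠ-≉0 n x≉0)

  ⁻¹-^ᶠ : ∀ {x} n → ¬ x ≈ 0# → (x ⁻¹) ^ᶠ n ≈ (x ^ᶠ n) ⁻¹
  ⁻¹-^ᶠ {x} n x≉0 = ⁻¹-unique (^ᶠ-≉0 n x≉0) (begin
    x ^ᶠ n * (x ⁻¹) ^ᶠ n   ≈⟨ ^ᶠ-distrib-* x (x ⁻¹) n ⟨
    (x * x ⁻¹) ^ᶠ n        ≈⟨ ^ᶠ-congˡ n (inverseʳ x x≉0) ⟩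
    1# ^ᶠ n                ≈⟨ ^ᶠ-zeroˡ n ⟩
    1#                     ∎)

  ^ᶠ-distrib-÷ : ∀ x {y} n → ¬ y ≈ 0# → (x ÷ y) ^ᶠ n ≈ (x ^ᶠ n) ÷ (y ^ᶠ n)
  ^ᶠ-distrib-÷ x {y} n y≉0 = trans (^ᶠ-distrib-* x (y ⁻¹) n) (*-congˡ (⁻¹-^ᶠ n y≉0))

  other-root : ∀ y z → z * z + z ≈ y * y + y → ¬ z ≈ y → z ≈ - (y + 1#)
  other-root y z same-value z≉y = +-inverseˡ-unique z (y + 1#) (x*y≈0⇒y≈0 z-y≉0 (begin
    (z - y) * (z + (y + 1#))                          ≈⟨ [y-z]x≈yx-zx (z + (y + 1#)) z y ⟩
    z * (z + (y + 1#)) - y * (z + (y + 1#))           ≈⟨ +-cong (expand z) (-‿cong (expand y)) ⟩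
    (z * z + (z * y + z)) - (y * z + (y * y + y))
      ≈⟨ +-cong (+-congˡ (+-congʳ (*-comm z y))) (-‿cong (+-congˡ (sym same-value))) ⟩
    (z * z + (y * z + z)) - (y * z + (z * z + z))
      ≈⟨ +-congʳ (+-Solver.solve 3 (λ a b c → a ⊕ (b ⊕ c) ⊜ b ⊕ (a ⊕ c)) refl (z * z) (y * z) z) ⟩
    (y * z + (z * z + z)) - (y * z + (z * z + z))     ≈⟨ -‿inverseʳ _ ⟩
    0#                                                ∎))
    where
      open +-Solver
      z-y≉0 : ¬ z - y ≈ 0#
      z-y≉0 z-y≈0 = z≉y (x∙y⁻¹≈ε⇒x≈y z y z-y≈0)
      expand : ∀ a → a * (z + (y + 1#)) ≈ a * z + (a * y + a)
      expand a = trans (distribˡ a z (y + 1#)) (+-congˡ (trans (distribˡ a y 1#) (+-congˡ (*-identityʳ a))))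

  -[-[y+1]+1]≈y : ∀ y → - (- (y + 1#) + 1#) ≈ y
  -[-[y+1]+1]≈y y = begin
    - (- (y + 1#) + 1#)     ≈⟨ -‿anti-homo-+ (- (y + 1#)) 1# ⟩
    - 1# + - - (y + 1#)     ≈⟨ +-congˡ (-‿involutive (y + 1#)) ⟩
    - 1# + (y + 1#)         ≈⟨ +-Solver.solve 3 (λ a b c → a ⊕ (b ⊕ c) ⊜ b ⊕ (c ⊕ a)) refl (- 1#) y 1# ⟩
    y + (1# + - 1#)         ≈⟨ +-congˡ (-‿inverseʳ 1#) ⟩
    y + 0#                  ≈⟨ +-identityʳ y ⟩
    y                       ∎
    where open +-Solver

  eval-cong : ∀ {q} (w : List (Fin q)) {x y} → x ≈ y → eval w x ≈ eval w y
  eval-cong []      x≈y = refl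
  eval-cong (_ ∷ w) x≈y = +-congˡ (*-cong x≈y (eval-cong w x≈y))

  prod-cong : ∀ {f g} j → (∀ k → 1 ≤ k → k ≤ j → f k ≈ g k) → prod f j ≈ prod g j
  prod-cong zero    f≈g = refl
  prod-cong (suc j) f≈g =
    *-cong (prod-cong j (λ k 1≤k k≤j → f≈g k 1≤k (ℕ.m≤n⇒m≤1+n k≤j))) (f≈g (suc j) (s≤s z≤n) ℕ.≤-refl)

  prod-telescope : ∀ (a : ℕ → Carrier) j → (∀ k → k ≤ j → ¬ a k ≈ 0#) →
    prod (λ k → a (k ∸ 1) ÷ a k) j ≈ a 0 ÷ a j
  prod-telescope a zero    a≉0 = sym (inverseʳ (a 0) (a≉0 0 z≤n))
  prod-telescope a (suc j) a≉0 = begin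
    prod (λ k → a (k ∸ 1) ÷ a k) j * (a j ÷ a (suc j))
      ≈⟨ *-congʳ (prod-telescope a j (λ k k≤j → a≉0 k (ℕ.m≤n⇒m≤1+n k≤j))) ⟩
    (a 0 ÷ a j) * (a j ÷ a (suc j))
      ≈⟨ x÷y*[y÷z]≈x÷z (a 0) (a (suc j)) (a≉0 j (ℕ.n≤1+n j)) ⟩
    a 0 ÷ a (suc j)
      ∎

  module _ (q : ℕ) where

    InGF-cong : ∀ m {x y} → x ≈ y → InGF q m x → InGF q m y
    InGF-cong m x≈y x∈ = trans (^ᶠ-congˡ (q ^ m) (sym x≈y)) (trans x∈ x≈y)

    IsSquareIn-cong : ∀ m {x y} → x ≈ y → IsSquareIn q m x → IsSquareIn q m y
    IsSquareIn-cong m x≈y (r , r∈ , r²≈x) = r , r∈ , trans r²≈x x≈y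

    IsSquareIn-1# : ∀ m → IsSquareIn q m 1#
    IsSquareIn-1# m = 1# , ^ᶠ-zeroˡ (q ^ m) , *-identityˡ 1#

    IsSquareIn-* : ∀ m {x y} → IsSquareIn q m x → IsSquareIn q m y → IsSquareIn q m (x * y)
    IsSquareIn-* m (r , r∈ , r²≈x) (s , s∈ , s²≈y) =
      r * s , trans (^ᶠ-distrib-* r s (q ^ m)) (*-cong r∈ s∈) ,
      trans (*-Solver.solve 2 (λ a b → (a ⊕ b) ⊕ (a ⊕ b) ⊜ (a ⊕ a) ⊕ (b ⊕ b)) refl r s) (*-cong r²≈x s²≈y)
      where open *-Solver

    IsSquareIn-prod : ∀ m f j → (∀ k → 1 ≤ k → k ≤ j → IsSquareIn q m (f k)) → IsSquareIn q m (prod f j)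
    IsSquareIn-prod m f zero    f-sq = IsSquareIn-1# m
    IsSquareIn-prod m f (suc j) f-sq = IsSquareIn-* m
      (IsSquareIn-prod m f j (λ k 1≤k k≤j → f-sq k 1≤k (ℕ.m≤n⇒m≤1+n k≤j)))
      (f-sq (suc j) (s≤s z≤n) ℕ.≤-refl)

    normExp-suc : ∀ m i → normExp q (suc m) 1 ℕ.* normExp q m i ≡ normExp q (suc m) (suc i)
    normExp-suc m zero    = ℕ.*-identityʳ _
    normExp-suc m (suc i) = ≡.trans
      (≡.sym (ℕ.*-assoc (normExp q (suc m) 1) (normExp q m i) _))
      (≡.cong (ℕ._* (q ^ (2 ^ (m ∸ suc i)) ℕ.+ 1)) (normExp-suc m i))

    N-trans : ∀ m i y → N q m i (N q (suc m) 1 y) ≈ N q (suc m) (suc i) y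
    N-trans m i y = begin
      (y ^ᶠ normExp q (suc m) 1) ^ᶠ normExp q m i     ≈⟨ ^ᶠ-assocʳ y (normExp q (suc m) 1) (normExp q m i) ⟩
      y ^ᶠ (normExp q (suc m) 1 ℕ.* normExp q m i)   ≡⟨ ≡.cong (y ^ᶠ_) (normExp-suc m i) ⟩
      y ^ᶠ normExp q (suc m) (suc i)                 ∎

    N-trans-÷ : ∀ m i x {y} → ¬ y ≈ 0# →
      N q m i (N q (suc m) 1 x ÷ y) ≈ N q (suc m) (suc i) x ÷ N q m i y
    N-trans-÷ m i x y≉0 = trans (^ᶠ-distrib-÷ _ (normExp q m i) y≉0) (*-congʳ (N-trans m i x))

    N÷≈prod : (x : ℕ → Carrier) → (∀ k → 1 ≤ k → ¬ x k ≈ 0#) → ∀ n j → j < n →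
      (N q n j (x n) ÷ x (n ∸ j))
        ≈ prod (λ k → N q (n ∸ k) (j ∸ k) (N q (n ∸ k +ℕ 1) 1 (x (n ∸ k +ℕ 1)) ÷ x (n ∸ k))) j
    N÷≈prod x x≉0 n j j<n = begin
      N q n j (x n) ÷ x (n ∸ j)        ≈⟨ *-congˡ (⁻¹-cong (x[n∸k]≉0 j j<n) a[j]≈x[n∸j]) ⟨
      a 0 ÷ a j                        ≈⟨ prod-telescope a j a≉0 ⟨
      prod (λ k → a (k ∸ 1) ÷ a k) j   ≈⟨ prod-cong j factor≈ ⟨
      prod factor j                    ∎
      where
        a : ℕ → Carrier
        a k = N q (n ∸ k) (j ∸ k) (x (n ∸ k))
        factor : ℕ → Carrier
        factor k = N q (n ∸ k) (j ∸ k) (N q (n ∸ k +ℕ 1) 1 (x (n ∸ k +ℕ 1)) ÷ x (n ∸ k))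
        x[n∸k]≉0 : ∀ k → k < n → ¬ x (n ∸ k) ≈ 0#
        x[n∸k]≉0 k k<n = x≉0 (n ∸ k) (ℕ.m<n⇒0<n∸m k<n)
        a≉0 : ∀ k → k ≤ j → ¬ a k ≈ 0#
        a≉0 k k≤j = ^ᶠ-≉0 (normExp q (n ∸ k) (j ∸ k)) (x[n∸k]≉0 k (ℕ.≤-<-trans k≤j j<n))
        a[j]≈x[n∸j] : a j ≈ x (n ∸ j)
        a[j]≈x[n∸j] = trans (reflexive (≡.cong (λ i → N q (n ∸ j) i (x (n ∸ j))) (ℕ.n∸n≡0 j)))
                            (^ᶠ-identityʳ (x (n ∸ j)))
        factor≈ : ∀ k → 1 ≤ k → k ≤ j → factor k ≈ a (k ∸ 1) ÷ a k
        factor≈ (suc k) _ 1+k≤j = begin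
          factor (suc k)
            ≡⟨ ≡.cong (λ p → N q m i (N q p 1 (x p) ÷ x m)) (ℕ.+-comm m 1) ⟩
          N q m i (N q (suc m) 1 (x (suc m)) ÷ x m)
            ≈⟨ N-trans-÷ m i (x (suc m)) (x[n∸k]≉0 (suc k) 1+k<n) ⟩
          N q (suc m) (suc i) (x (suc m)) ÷ a (suc k)
            ≡⟨ ≡.cong₂ (λ m′ i′ → N q m′ i′ (x m′) ÷ a (suc k))
                       (1+[m∸1+k]≡m∸k (ℕ.<-trans 1+k≤j j<n)) (1+[m∸1+k]≡m∸k 1+k≤j) ⟩
          a k ÷ a (suc k)
            ∎
          where
            m : ℕ
            m = n ∸ suc k
            i : ℕ
            i = j ∸ suc k
            1+k<n : suc k < n
            1+k<n = ℕ.≤-<-trans 1+k≤j j<n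

    -- The norm from GF(Q²) down to GF(Q) is t ↦ t^(Q+1).
    x^[Q*Q]≈x⇒x^[Q+1]^Q≈x^[Q+1] : ∀ t Q → t ^ᶠ (Q ℕ.* Q) ≈ t → (t ^ᶠ (Q ℕ.+ 1)) ^ᶠ Q ≈ t ^ᶠ (Q ℕ.+ 1)
    x^[Q*Q]≈x⇒x^[Q+1]^Q≈x^[Q+1] t Q t∈ = begin
      (t ^ᶠ (Q ℕ.+ 1)) ^ᶠ Q        ≈⟨ ^ᶠ-assocʳ t (Q ℕ.+ 1) Q ⟩
      t ^ᶠ ((Q ℕ.+ 1) ℕ.* Q)       ≡⟨ ≡.cong (t ^ᶠ_) (exponent Q) ⟩
      t ^ᶠ (Q ℕ.* Q ℕ.+ Q)         ≈⟨ ^ᶠ-homo-* t (Q ℕ.* Q) Q ⟩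
      t ^ᶠ (Q ℕ.* Q) * t ^ᶠ Q      ≈⟨ *-congʳ t∈ ⟩
      t * t ^ᶠ Q                   ≡⟨ ≡.cong (t ^ᶠ_) (ℕ.+-comm 1 Q) ⟩
      t ^ᶠ (Q ℕ.+ 1)               ∎
      where
        exponent : ∀ Q → (Q ℕ.+ 1) ℕ.* Q ≡ Q ℕ.* Q ℕ.+ Q
        exponent = solve-∀

    N-InGF : ∀ m i {s} → i ≤ m → InGF q (2 ^ m) s → InGF q (2 ^ (m ∸ i)) (N q m i s)
    N-InGF m zero    _    s∈ = InGF-cong (2 ^ m) (sym (^ᶠ-identityʳ _)) s∈
    N-InGF m (suc i) {s} i<m s∈ =
      InGF-cong (2 ^ (m ∸ suc i)) (^ᶠ-assocʳ s (normExp q m i) (R ℕ.+ 1))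
        (x^[Q*Q]≈x⇒x^[Q+1]^Q≈x^[Q+1] (N q m i s) R
          (≡.subst (λ e → N q m i s ^ᶠ e ≈ N q m i s) R*R≡q^2^[m∸i] (N-InGF m i (ℕ.<⇒≤ i<m) s∈)))
      where
        R : ℕ
        R = q ^ (2 ^ (m ∸ suc i))
        R*R≡q^2^[m∸i] : q ^ (2 ^ (m ∸ i)) ≡ R ℕ.* R
        R*R≡q^2^[m∸i] = ≡.trans (≡.cong (λ e → q ^ (2 ^ e)) (≡.sym (1+[m∸1+k]≡m∸k i<m)))
                                (q^2^[1+t]≡q^2^t*q^2^t q (m ∸ suc i))

    N-IsSquareIn : ∀ m i {z} → i ≤ m → IsSquareIn q (2 ^ m) z → IsSquareIn q (2 ^ (m ∸ i)) (N q m i z)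
    N-IsSquareIn m i i≤m (r , r∈ , r²≈z) =
      N q m i r , N-InGF m i i≤m r∈ ,
      trans (sym (^ᶠ-distrib-* r r (normExp q m i))) (^ᶠ-congˡ (normExp q m i) r²≈z)

  ·≈ι* : ∀ n x → n · x ≈ ι n * x
  ·≈ι* zero    x = sym (zeroˡ x)
  ·≈ι* (suc n) x = trans (+-cong (sym (*-identityˡ x)) (·≈ι* n x)) (sym (distribʳ x 1# (ι n)))

  ^ᶠ≈^ˢ : ∀ x n → x ^ᶠ n ≈ x ^ˢ n
  ^ᶠ≈^ˢ x zero    = refl
  ^ᶠ≈^ˢ x (suc n) = *-congˡ (^ᶠ≈^ˢ x n)

  char∣⇒·≈0 : ∀ {p m} → ι p ≈ 0# → p ∣ m → ∀ x → m · x ≈ 0#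
  char∣⇒·≈0 {p} char-p (divides d ≡.refl) x = begin
    (d ℕ.* p) · x   ≈⟨ ×-assocˡ x d p ⟨
    d · (p · x)     ≈⟨ ×-congʳ d (trans (·≈ι* p x) (trans (*-congʳ char-p) (zeroˡ x))) ⟩
    d · 0#          ≈⟨ ·≈ι* d 0# ⟩
    ι d * 0#        ≈⟨ zeroʳ _ ⟩
    0#              ∎

  binomialTerm-first : ∀ x y n → binomialTerm x y n fzero ≈ y ^ᶠ n
  binomialTerm-first x y n = begin
    (n C 0) · (1# * y ^ˢ n)   ≡⟨ ≡.cong (_· (1# * y ^ˢ n)) (≡.trans (nCk≡nC[n∸k] {n = n} z≤n) (nCn≡1 n)) ⟩
    1 · (1# * y ^ˢ n)         ≈⟨ trans (×-homo-1 _) (*-identityˡ _) ⟩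
    y ^ˢ n                    ≈⟨ ^ᶠ≈^ˢ y n ⟨
    y ^ᶠ n                    ∎

  binomialTerm-last : ∀ x y n → binomialTerm x y n (fromℕ n) ≈ x ^ᶠ n
  binomialTerm-last x y n rewrite toℕ-fromℕ n | nCn≡1 n | ℕ.n∸n≡0 n =
    trans (×-homo-1 _) (trans (*-identityʳ _) (sym (^ᶠ≈^ˢ x n)))

  -- All inner binomial coefficients pC1, …, pC(p−1) vanish in characteristic p.
  frobenius-+ : ∀ {p} → Prime p → ι p ≈ 0# → ∀ x y → (x + y) ^ᶠ p ≈ x ^ᶠ p + y ^ᶠ p
  frobenius-+ {0} ()
  frobenius-+ {1} ()
  frobenius-+ {p@(suc (suc r))} p-prime char-p x y = begin
    (x + y) ^ᶠ p                                    ≈⟨ ^ᶠ≈^ˢ (x + y) p ⟩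
    (x + y) ^ˢ p                                    ≈⟨ theorem p x y ⟩
    term fzero + sum (λ i → term (fsuc i))          ≈⟨ +-congˡ (sum-init-last (λ i → term (fsuc i))) ⟩
    term fzero + (sum inner + term (fromℕ p))
      ≈⟨ +-cong (binomialTerm-first x y p) (+-cong inner≈0 (binomialTerm-last x y p)) ⟩
    y ^ᶠ p + (0# + x ^ᶠ p)                          ≈⟨ trans (+-congˡ (+-identityˡ _)) (+-comm _ _) ⟩
    x ^ᶠ p + y ^ᶠ p                                 ∎
    where
      term : Fin (suc p) → Carrier
      term = binomialTerm x y p
      inner : Fin (suc r) → Carrier
      inner i = term (fsuc (inject₁ i))
      inner≈0 : sum inner ≈ 0#
      inner≈0 = trans
        (sum-cong-≋ {x = inner} {y = λ _ → 0#}
          (λ i → char∣⇒·≈0 char-p (prime∣pCk p-prime (s≤s z≤n) (s≤s (inject₁ℕ< i))) _))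
        (sum-replicate-zero (suc r))

  module Frobenius {q} (q-prime : Prime q) (char-q : ι q ≈ 0#) where

    φ : ℕ → Carrier → Carrier
    φ t x = x ^ᶠ (q ^ t)

    φ-cong : ∀ t {x y} → x ≈ y → φ t x ≈ φ t y
    φ-cong t = ^ᶠ-congˡ (q ^ t)

    φ-* : ∀ t x y → φ t (x * y) ≈ φ t x * φ t y
    φ-* t x y = ^ᶠ-distrib-* x y (q ^ t)

    φ-1# : ∀ t → φ t 1# ≈ 1#
    φ-1# t = ^ᶠ-zeroˡ (q ^ t)

    φ-+ : ∀ t x y → φ t (x + y) ≈ φ t x + φ t y
    φ-+ zero    x y = trans (^ᶠ-identityʳ _) (sym (+-cong (^ᶠ-identityʳ x) (^ᶠ-identityʳ y)))
    φ-+ (suc t) x y = begin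
      φ (suc t) (x + y)               ≈⟨ ^ᶠ-assocʳ (x + y) q (q ^ t) ⟨
      φ t ((x + y) ^ᶠ q)              ≈⟨ φ-cong t (frobenius-+ q-prime char-q x y) ⟩
      φ t (x ^ᶠ q + y ^ᶠ q)           ≈⟨ φ-+ t _ _ ⟩
      φ t (x ^ᶠ q) + φ t (y ^ᶠ q)     ≈⟨ +-cong (^ᶠ-assocʳ x q (q ^ t)) (^ᶠ-assocʳ y q (q ^ t)) ⟩
      φ (suc t) x + φ (suc t) y       ∎

    φ-0# : ∀ t → φ t 0# ≈ 0#
    φ-0# t = x+x≈x⇒x≈0 (φ t 0#) (trans (sym (φ-+ t 0# 0#)) (φ-cong t (+-identityˡ 0#)))

    φ-‿ : ∀ t x → φ t (- x) ≈ - φ t x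
    φ-‿ t x = +-inverseʳ-unique (φ t x) (φ t (- x))
      (trans (sym (φ-+ t x (- x))) (trans (φ-cong t (-‿inverseʳ x)) (φ-0# t)))

    φ-ι : ∀ t n → φ t (ι n) ≈ ι n
    φ-ι t zero    = φ-0# t
    φ-ι t (suc n) = trans (φ-+ t 1# (ι n)) (+-cong (φ-1# t) (φ-ι t n))

    φ-eval : ∀ t (w : List (Fin q)) x → φ t (eval w x) ≈ eval w (φ t x)
    φ-eval t []      x = φ-0# t
    φ-eval t (a ∷ w) x =
      trans (φ-+ t _ _) (+-cong (φ-ι t (toℕ a)) (trans (φ-* t x _) (*-congˡ (φ-eval t w x))))

    φ-double : ∀ t x → φ (2 ^ suc t) x ≈ φ (2 ^ t) (φ (2 ^ t) x)
    φ-double t x = trans (reflexive (≡.cong (x ^ᶠ_) (q^2^[1+t]≡q^2^t*q^2^t q t)))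
                         (sym (^ᶠ-assocʳ x (q ^ (2 ^ t)) (q ^ (2 ^ t))))

  module Tower {q} (q-prime : Prime q) (char-q : ι q ≈ 0#)
    (v : List (Fin q)) (x : ℕ → Carrier)
    (x₁∈GF : InGF q 2 (x 1))
    (root : ∀ k → 2 ≤ k → fxy v (x (k ∸ 1)) (x k) ≈ 0#)
    (new : ∀ k → 2 ≤ k → ¬ InGF q (2 ^ (k ∸ 1)) (x k))
    where
    open Frobenius q-prime char-q

    x[1+m]²+x[1+m]≈v[x[m]] : ∀ m → 1 ≤ m → x (suc m) * x (suc m) + x (suc m) ≈ eval v (x m)
    x[1+m]²+x[1+m]≈v[x[m]] m 1≤m = x∙y⁻¹≈ε⇒x≈y _ _ (root (suc m) (s≤s 1≤m))

    conjugate-of-InGF : ∀ m → 1 ≤ m → InGF q (2 ^ m) (x m) → φ (2 ^ m) (x (suc m)) ≈ - (x (suc m) + 1#)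
    conjugate-of-InGF m 1≤m x[m]∈GF = other-root y (φ T y) (begin
      φ T y * φ T y + φ T y   ≈⟨ +-congʳ (φ-* T y y) ⟨
      φ T (y * y) + φ T y     ≈⟨ φ-+ T (y * y) y ⟨
      φ T (y * y + y)         ≈⟨ φ-cong T (x[1+m]²+x[1+m]≈v[x[m]] m 1≤m) ⟩
      φ T (eval v (x m))      ≈⟨ φ-eval T v (x m) ⟩
      eval v (φ T (x m))      ≈⟨ eval-cong v x[m]∈GF ⟩
      eval v (x m)            ≈⟨ x[1+m]²+x[1+m]≈v[x[m]] m 1≤m ⟨
      y * y + y               ∎)
      (new (suc m) (s≤s 1≤m))
      where
        T : ℕ
        T = 2 ^ m
        y : Carrier
        y = x (suc m)

    InGF-step : ∀ m → 1 ≤ m → InGF q (2 ^ m) (x m) → InGF q (2 ^ suc m) (x (suc m))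
    InGF-step m 1≤m x[m]∈GF = begin
      φ (2 ^ suc m) y           ≈⟨ φ-double m y ⟩
      φ T (φ T y)               ≈⟨ φ-cong T conjugate ⟩
      φ T (- (y + 1#))          ≈⟨ φ-‿ T (y + 1#) ⟩
      - φ T (y + 1#)            ≈⟨ -‿cong (φ-+ T y 1#) ⟩
      - (φ T y + φ T 1#)        ≈⟨ -‿cong (+-cong conjugate (φ-1# T)) ⟩
      - (- (y + 1#) + 1#)       ≈⟨ -[-[y+1]+1]≈y y ⟩
      y                         ∎
      where
        T : ℕ
        T = 2 ^ m
        y : Carrier
        y = x (suc m)
        conjugate : φ T y ≈ - (y + 1#)
        conjugate = conjugate-of-InGF m 1≤m x[m]∈GF

    x-InGF : ∀ m → 1 ≤ m → InGF q (2 ^ m) (x m)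
    x-InGF (suc zero)    _ = x₁∈GF
    x-InGF (suc (suc m)) _ = InGF-step (suc m) (s≤s z≤n) (x-InGF (suc m) (s≤s z≤n))

    N₁-x[1+m]≈f[x[m],0] : ∀ m → 1 ≤ m → N q (suc m) 1 (x (suc m)) ≈ fxy v (x m) 0#
    N₁-x[1+m]≈f[x[m],0] m 1≤m = begin
      y ^ᶠ normExp q (suc m) 1        ≡⟨ ≡.cong (y ^ᶠ_) (ℕ.*-identityˡ (Q ℕ.+ 1)) ⟩
      y ^ᶠ (Q ℕ.+ 1)                  ≈⟨ ^ᶠ-homo-* y Q 1 ⟩
      y ^ᶠ Q * y ^ᶠ 1                 ≈⟨ *-cong (conjugate-of-InGF m 1≤m (x-InGF m 1≤m)) (^ᶠ-identityʳ y) ⟩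
      - (y + 1#) * y                  ≈⟨ -‿distribˡ-* (y + 1#) y ⟨
      - ((y + 1#) * y)                ≈⟨ -‿cong (trans (distribʳ y y 1#) (+-congˡ (*-identityˡ y))) ⟩
      - (y * y + y)                   ≈⟨ -‿cong (x[1+m]²+x[1+m]≈v[x[m]] m 1≤m) ⟩
      - eval v (x m)                  ≈⟨ +-identityˡ _ ⟨
      0# - eval v (x m)               ≈⟨ +-congʳ (trans (+-identityʳ _) (zeroˡ 0#)) ⟨
      (0# * 0# + 0#) - eval v (x m)   ∎
      where
        Q : ℕ
        Q = q ^ (2 ^ m)
        y : Carrier
        y = x (suc m)

    module _ (condition₁ : ∀ k → 2 ≤ k → IsSquareIn q (2 ^ (k ∸ 1)) (fxy v (x (k ∸ 1)) 0# ÷ x (k ∸ 1))) where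

      N₁-x[m+1]÷x[m]-square : ∀ m → 1 ≤ m → IsSquareIn q (2 ^ m) (N q (m +ℕ 1) 1 (x (m +ℕ 1)) ÷ x m)
      N₁-x[m+1]÷x[m]-square m 1≤m rewrite ℕ.+-comm m 1 =
        IsSquareIn-cong q (2 ^ m) (*-congʳ (sym (N₁-x[1+m]≈f[x[m],0] m 1≤m))) (condition₁ (suc m) (s≤s 1≤m))

      factor-square : ∀ n j k → k ≤ j → j < n →
        IsSquareIn q (2 ^ (n ∸ j)) (N q (n ∸ k) (j ∸ k) (N q (n ∸ k +ℕ 1) 1 (x (n ∸ k +ℕ 1)) ÷ x (n ∸ k)))
      factor-square n j k k≤j j<n =
        ≡.subst (λ e → IsSquareIn q (2 ^ e) (N q m i (N q (m +ℕ 1) 1 (x (m +ℕ 1)) ÷ x m)))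
          ([n∸k]∸[j∸k]≡n∸j n k≤j)
          (N-IsSquareIn q (n ∸ k) (j ∸ k) (ℕ.∸-monoˡ-≤ k (ℕ.<⇒≤ j<n))
            (N₁-x[m+1]÷x[m]-square (n ∸ k) (ℕ.m<n⇒0<n∸m (ℕ.≤-<-trans k≤j j<n))))
        where
          m : ℕ
          m = n ∸ k
          i : ℕ
          i = j ∸ k

lemma3p4 : {c ℓ : Level} (F : Field c ℓ) (q : ℕ) → Prime q → q % 2 ≡ 1 →
    let open Field F in
    let open FieldNotions F in
    ι q ≈ 0# →
    (v : List (Fin q)) → NonZeroPoly v →
    (x : ℕ → Carrier) →
    InGF q 2 (x 1) →
    (∀ k → 2 ≤ k → fxy v (x (k ∸ 1)) (x k) ≈ 0#) →
    (∀ k → 2 ≤ k → ¬ InGF q (2 ^ (k ∸ 1)) (x k)) →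
    (∀ k → 1 ≤ k → ¬ (x k ≈ 0#)) →
    (∀ k → 2 ≤ k → IsSquareIn q (2 ^ (k ∸ 1)) (fxy v (x (k ∸ 1)) 0# ÷ x (k ∸ 1))) →
    (n j : ℕ) → 2 ≤ n → 1 ≤ j → j < n →
    ((N q n j (x n) ÷ x (n ∸ j))
        ≈ prod (λ k → N q (n ∸ k) (j ∸ k) (N q (n ∸ k +ℕ 1) 1 (x (n ∸ k +ℕ 1)) ÷ x (n ∸ k))) j)
    × IsSquareIn q (2 ^ (n ∸ j)) (N q n j (x n) ÷ x (n ∸ j))
lemma3p4 F q q-prime _ char-q v _ x x₁∈GF root new x≉0 condition₁ n j _ _ j<n =
  N÷≈prod q x x≉0 n j j<n ,
  IsSquareIn-cong q (2 ^ (n ∸ j)) (sym (N÷≈prod q x x≉0 n j j<n))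
    (IsSquareIn-prod q (2 ^ (n ∸ j)) _ j (λ k _ k≤j → factor-square condition₁ n j k k≤j j<n))
  where
    open Field F using (sym)
    open FieldTheory F
    open Tower q-prime char-q v x x₁∈GF root new
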